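{- Every connected unit interval graph $G$ has a spanning even tree, unless $G$ is isomorphic to a path of odd length.
   Context: All graphs are finite and simple. A graph $G=(V,E)$ is a unit interval graph if there is a family of closed intervals $\{I_v : v\in V\}$ of the real line, all of the same (unit) length, such that distinct $u,v$ are adjacent in $G$ if and only if $I_u\cap I_v\neq\emptyset$. The length of a path is its number of edges. A leaf of a tree is a vertex of degree $1$. A tree is even if for every pair of distinct leaves, the number of edges of the unique path between them is even. A spanning even tree of $G$ is a spanning tree of $G$ that is even.
   Formalization: The unit intervals representing $G$ have rational endpoints, in place of arbitrary closed unit intervals of the real line. -}

module Defs where

open import Level using (0ℓ)
open import Data.Nat using (ℕ; zero; suc; _≤_)
open import Data.Nat.Divisibility using (_∣_)
open import Data.Fin using (Fin; toℕ)
open import Data.List using (List; []; _∷_; _++_; [_]; length)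
open import Data.List.Relation.Unary.Unique.Propositional using (Unique)
open import Data.Product using (Σ; ∃; _×_)
open import Data.Sum using (_⊎_)
open import Data.Rational using (ℚ; _+_; 1ℚ)
import Data.Rational as Q
open import Relation.Nullary using (¬_)
open import Relation.Binary.PropositionalEquality using (_≡_; _≢_)
open import Function.Bundles using (_↔_; Inverse; _⇔_)

record Graph (n : ℕ) : Set₁ where
  field
    Adj    : Fin n → Fin n → Set
    sym    : ∀ {u v} → Adj u v → Adj v u
    irrefl : ∀ {u} → ¬ Adj u u
open Graph public

Rel : ℕ → Set₁
Rel n = Fin n → Fin n → Set

data Chain {n : ℕ} (R : Rel n) : List (Fin n) → Set where
  nil  : Chain R []
  one  : ∀ x → Chain R [ x ]
  cons : ∀ {x y vs} → R x y → Chain R (y ∷ vs) → Chain R (x ∷ y ∷ vs)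

data Ends {n : ℕ} : Fin n → Fin n → List (Fin n) → Set where
  single : ∀ x → Ends x x [ x ]
  extend : ∀ {x y z vs} → Ends y z (y ∷ vs) → Ends x z (x ∷ y ∷ vs)

IsPath : ∀ {n} → Rel n → Fin n → Fin n → List (Fin n) → Set
IsPath R x y p = Chain R p × Unique p × Ends x y p

pathLength : ∀ {n} → List (Fin n) → ℕ
pathLength []       = 0
pathLength (_ ∷ vs) = length vs

Connected : ∀ {n} → Rel n → Set
Connected {n} R = ∀ (x y : Fin n) → ∃ λ p → IsPath R x y p

HasCycle : ∀ {n} → Rel n → Set
HasCycle {n} R = Σ (Fin n) λ x → Σ (List (Fin n)) λ vs →
  Unique (x ∷ vs) × 2 ≤ length vs × Chain R ((x ∷ vs) ++ [ x ])

IsSpanningTree : ∀ {n} → Graph n → Rel n → Set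
IsSpanningTree G T =
  (∀ {u v} → T u v → Adj G u v) ×
  (∀ {u v} → T u v → T v u) ×
  Connected T × ¬ HasCycle T

IsLeaf : ∀ {n} → Rel n → Fin n → Set
IsLeaf {n} T x = Σ (Fin n) λ y → T x y × (∀ z → T x z → z ≡ y)

Even : ℕ → Set
Even k = 2 ∣ k

IsEvenTree : ∀ {n} → Rel n → Set
IsEvenTree {n} T = ∀ (x y : Fin n) → IsLeaf T x → IsLeaf T y → x ≢ y →
  ∀ p → IsPath T x y p → Even (pathLength p)

HasSpanningEvenTree : ∀ {n} → Graph n → Set₁
HasSpanningEvenTree {n} G = Σ (Rel n) λ T → IsSpanningTree G T × IsEvenTree T

ConnectedGraph : ∀ {n} → Graph n → Set
ConnectedGraph G = Connected (Adj G)

-- Unit interval graph: closed intervals [a v, a v + 1], adjacency iff they intersect.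
-- (Left endpoints are rational.)
Intersect : ℚ → ℚ → Set
Intersect a b = Σ ℚ λ x → (a Q.≤ x × x Q.≤ a + 1ℚ) × (b Q.≤ x × x Q.≤ b + 1ℚ)

IsUnitInterval : ∀ {n} → Graph n → Set
IsUnitInterval {n} G = Σ (Fin n → ℚ) λ a →
  ∀ (u v : Fin n) → u ≢ v → (Adj G u v ⇔ Intersect (a u) (a v))

PathAdj : ∀ {m} → Fin m → Fin m → Set
PathAdj i j = suc (toℕ i) ≡ toℕ j ⊎ suc (toℕ j) ≡ toℕ i

IsoToOddPath : ∀ {n} → Graph n → Set
IsoToOddPath {n} G = Σ ℕ λ k → ¬ Even k × Σ (Fin n ↔ Fin (suc k)) λ f →
  ∀ (u v : Fin n) → (Adj G u v ⇔ PathAdj (Inverse.to f u) (Inverse.to f v))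

{-# OPTIONS --safe #-}

-- Sort the vertices by the left ends a of their intervals. Consecutive vertices v_i, v_{i+1}
-- are adjacent: a path between them leaves {v₀, …, v_i} along some edge uv, and then
-- a(v_{i+1}) ≤ a(v) ≤ a(u) + 1 ≤ a(v_i) + 1. So v₀ … v_M is a Hamiltonian path, an even
-- spanning tree when M is even. If M is odd and some v_i v_{i+2} is an edge, reversing the
-- order if necessary makes i odd; replacing v_{i+1} v_{i+2} by the chord v_i v_{i+2} gives a
-- tree whose leaves, among v₀, v_{i+1} and v_M, all have even depth, so paths between leaves
-- are even. If there is no such chord, the same inequalities allow only edges between
-- consecutive vertices, and G is the path of odd length M.

module Submission where

open import Defs renaming (sym to Adj-sym)
open import Data.Empty using (⊥; ⊥-elim)
open import Data.Fin as Fin using (Fin; zero; suc; toℕ; fromℕ; fromℕ<; inject₁; opposite)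
import Data.Fin.Properties as Fin
open import Data.Fin.Permutation as Perm
  using (Permutation′; _⟨$⟩ʳ_; _⟨$⟩ˡ_; inverseˡ; inverseʳ; _∘ₚ_)
open import Data.List using (List; []; _∷_; _++_; [_]; length)
open import Data.List.Membership.Propositional using (_∈_; _∉_)
open import Data.List.Membership.Propositional.Properties using (∈-++⁺ʳ)
open import Data.List.Relation.Unary.All as All using (All; []; _∷_)
open import Data.List.Relation.Unary.All.Properties using (¬Any⇒All¬)
open import Data.List.Relation.Unary.AllPairs using ([]; _∷_)
open import Data.List.Relation.Unary.Any using (here; there; any?)
open import Data.List.Relation.Unary.Linked as Linked using (Linked; [-]; _∷_)
open import Data.List.Relation.Unary.Linked.Properties using (Linked⇒AllPairs)
open import Data.List.Relation.Unary.Unique.Propositional using (Unique)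
open import Data.Nat using (ℕ; zero; suc; pred; parity; _+_; _∸_; _≤_; _<_; _>_; _≤?_; s≤s)
import Data.Nat.Properties as ℕ
open import Data.Nat.Divisibility using (divides)
open import Data.Parity as ℙ using (0ℙ; 1ℙ; _⁻¹)
open import Data.Parity.Properties
  using (suc-homo-⁻¹; *-homo-*; +-homo-+; ⁻¹-selfInverse; ⁻¹-involutive)
import Data.Parity.Properties as ℙ
open import Data.Product using (∃; ∃₂; _×_; _,_; proj₁; proj₂)
open import Data.Rational as ℚ using (ℚ; 1ℚ)
import Data.Rational.Properties as ℚ
open import Data.Sum using (_⊎_; inj₁; inj₂)
open import Data.Unit using (⊤; tt)
open import Function using (_on_; _∘_)
open import Function.Bundles using (_⇔_; Equivalence; mk⇔)
open import Relation.Binary.Bundles using (TotalPreorder)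
open import Relation.Binary.Construct.Closure.ReflexiveTransitive as Star using (Star; ε; _◅_; _◅◅_)
open import Relation.Binary.Definitions using (Transitive; tri<; tri≈; tri>)
open import Relation.Binary.PropositionalEquality
  using (_≡_; _≢_; refl; sym; trans; cong; cong₂; subst; subst₂; ≢-sym; module ≡-Reasoning)
open import Relation.Nullary using (¬_; Dec; yes; no)
open import Relation.Nullary.Decidable using (_×-dec_)

-- Parity

parity-suc : ∀ k → parity (suc k) ≡ parity k ⁻¹
parity-suc k = sym (⁻¹-selfInverse (suc-homo-⁻¹ k))

⁻¹-distribˡ-+ : ∀ p q → (p ℙ.+ q) ⁻¹ ≡ p ⁻¹ ℙ.+ q
⁻¹-distribˡ-+ 0ℙ q = refl
⁻¹-distribˡ-+ 1ℙ q = ⁻¹-involutive q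

parity≡0ℙ⇒even : ∀ k → parity k ≡ 0ℙ → Even k
parity≡0ℙ⇒even zero          _    = divides 0 refl
parity≡0ℙ⇒even (suc (suc k)) even with parity≡0ℙ⇒even k even
... | divides q refl = divides (suc q) refl

even⇒parity≡0ℙ : ∀ {k} → Even k → parity k ≡ 0ℙ
even⇒parity≡0ℙ (divides q refl) = trans (*-homo-* q 2) (ℙ.*-zeroʳ (parity q))

parity≡1ℙ⇒odd : ∀ {k} → parity k ≡ 1ℙ → ¬ Even k
parity≡1ℙ⇒odd odd even with trans (sym (even⇒parity≡0ℙ even)) odd
... | ()

parity-∸ : ∀ {m n} → n ≤ m → parity (m ∸ n) ℙ.+ parity n ≡ parity m
parity-∸ {m} {n} n≤m = trans (sym (+-homo-+ (m ∸ n) n)) (cong parity (ℕ.m∸n+n≡m n≤m))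

-- Paths and walks

module _ {n : ℕ} {R : Rel n} where

  Path : Fin n → Fin n → Set
  Path x y = ∃ (IsPath R x y)

  suffix-from : ∀ {x z y p} → x ∈ p → IsPath R z y p → Path x y
  suffix-from (here refl) path@(_ , _ , single _) = _ , path
  suffix-from (here refl) path@(_ , _ , extend _) = _ , path
  suffix-from (there x∈p) (cons _ chain , _ ∷ unique , extend ends) =
    suffix-from x∈p (chain , unique , ends)

  prepend : ∀ {x z y p} → R x z → x ∉ p → IsPath R z y p → Path x y
  prepend r x∉p (chain , unique , single _) =
    _ , cons r chain , ¬Any⇒All¬ _ x∉p ∷ unique , extend (single _)
  prepend r x∉p (chain , unique , extend ends) =
    _ , cons r chain , ¬Any⇒All¬ _ x∉p ∷ unique , extend (extend ends)

  walk⇒path : ∀ {x y} → Star R x y → Path x y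
  walk⇒path {x} ε = [ x ] , one x , [] ∷ [] , single x
  walk⇒path {x} (r ◅ walk) with walk⇒path walk
  ... | p , path with any? (x Fin.≟_) p
  ... | yes x∈p = suffix-from x∈p path
  ... | no x∉p = prepend r x∉p path

  connected-via-hub : (∀ {u v} → R u v → R v u) → (hub : Fin n) →
                      (∀ v → Star R v hub) → Connected R
  connected-via-hub R-sym hub to-hub x y = walk⇒path (to-hub x ◅◅ Star.reverse R-sym (to-hub y))

  crossing-edge : (P : Fin n → Set) → (∀ v → Dec (P v)) → ∀ {x y p} →
                  Chain R p → Ends x y p → P x → ¬ P y → ∃₂ λ u v → R u v × P u × ¬ P v
  crossing-edge P P? _ (single _) Px ¬Px = ⊥-elim (¬Px Px)
  crossing-edge P P? (cons r chain) (extend {y = z} ends) Px ¬Py with P? z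
  ... | yes Pz = crossing-edge P P? chain ends Pz ¬Py
  ... | no ¬Pz = _ , _ , r , Px , ¬Pz

  chain-snoc : ∀ p {y z} → Chain R (p ++ [ y ]) → R y z → Chain R (p ++ y ∷ z ∷ [])
  chain-snoc []              _               r = cons r (one _)
  chain-snoc (_ ∷ [])        (cons r′ _)     r = cons r′ (cons r (one _))
  chain-snoc (_ ∷ _ ∷ p)     (cons r′ chain) r = cons r′ (chain-snoc (_ ∷ p) chain r)

NonBacktracking : ∀ {A : Set} → List A → Set
NonBacktracking (u ∷ v ∷ w ∷ rest) = u ≢ w × NonBacktracking (v ∷ w ∷ rest)
NonBacktracking _                  = ⊤

-- For x = a and y = b: a cycle a b c … traversed once and continued by one step.
cycle-nonBacktracking : ∀ {A : Set} {a b c x y : A} ws → Unique (a ∷ b ∷ c ∷ ws) →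
                        All (_≢ x) (b ∷ c ∷ ws) → All (_≢ y) (c ∷ ws) →
                        NonBacktracking (a ∷ b ∷ c ∷ ws ++ x ∷ y ∷ [])
cycle-nonBacktracking []       ((_ ∷ a≢c ∷ _) ∷ _) (b≢x ∷ _) (c≢y ∷ _) = a≢c , b≢x , c≢y , tt
cycle-nonBacktracking (_ ∷ ws) ((_ ∷ a≢c ∷ _) ∷ unique) (_ ∷ ≢x) (_ ∷ ≢y) =
  a≢c , cycle-nonBacktracking ws unique ≢x ≢y

head∉tail : ∀ {A : Set} {R : A → A → Set} → Transitive R → (∀ {x} → ¬ R x x) →
            ∀ {x xs} → Linked R (x ∷ xs) → x ∉ xs
head∉tail R-trans R-irrefl linked x∈xs with Linked⇒AllPairs R-trans linked
... | R-x ∷ _ = R-irrefl (All.lookup R-x x∈xs)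

-- Trees given by parent pointers

module RootedTree {n : ℕ} (root : Fin n) (parent : Fin n → Fin n) (depth : Fin n → ℕ)
  (depth-parent : ∀ {v} → v ≢ root → suc (depth (parent v)) ≡ depth v) where

  Edge : Rel n
  Edge u v = (u ≢ root × v ≡ parent u) ⊎ (v ≢ root × u ≡ parent v)

  Edge-sym : ∀ {u v} → Edge u v → Edge v u
  Edge-sym (inj₁ e) = inj₂ e
  Edge-sym (inj₂ e) = inj₁ e

  edge-depth : ∀ {u v} → Edge u v → suc (depth v) ≡ depth u ⊎ suc (depth u) ≡ depth v
  edge-depth (inj₁ (u≢root , refl)) = inj₁ (depth-parent u≢root)
  edge-depth (inj₂ (v≢root , refl)) = inj₂ (depth-parent v≢root)

  edge-direction : ∀ {u v} → Edge u v → depth v < depth u ⊎ depth u < depth v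
  edge-direction e with edge-depth e
  ... | inj₁ eq = inj₁ (ℕ.≤-reflexive eq)
  ... | inj₂ eq = inj₂ (ℕ.≤-reflexive eq)

  lower-end-is-parent : ∀ {u v} → Edge u v → depth u < depth v → u ≡ parent v
  lower-end-is-parent (inj₁ (u≢root , refl)) u<v =
    ⊥-elim (ℕ.<-asym u<v (ℕ.≤-reflexive (depth-parent u≢root)))
  lower-end-is-parent (inj₂ (_ , u≡parent)) _ = u≡parent

  walk-to-root : ∀ v → Star Edge v root
  walk-to-root v = climb (depth v) v refl
    where
    climb : ∀ d v → depth v ≡ d → Star Edge v root
    climb d v depth≡d with v Fin.≟ root
    ... | yes refl = ε
    climb zero v depth≡0 | no v≢root with trans (depth-parent v≢root) depth≡0
    ... | ()
    climb (suc d) v depth≡d | no v≢root =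
      inj₁ (v≢root , refl) ◅ climb d (parent v) (ℕ.suc-injective (trans (depth-parent v≢root) depth≡d))

  connected : Connected Edge
  connected = connected-via-hub Edge-sym root walk-to-root

  Ascending Descending : List (Fin n) → Set
  Ascending  = Linked (_<_ on depth)
  Descending = Linked (_>_ on depth)

  EndsAscending : List (Fin n) → Set
  EndsAscending (u ∷ v ∷ [])       = depth u < depth v
  EndsAscending (_ ∷ v ∷ w ∷ rest) = EndsAscending (v ∷ w ∷ rest)
  EndsAscending _                  = ⊥

  -- Going up from u to v makes u the parent of v, so the next step cannot go down again.
  ascent-continues : ∀ {u v w} → Edge u v → Edge v w → u ≢ w → depth u < depth v → depth v < depth w
  ascent-continues uv vw u≢w u<v with edge-direction vw
  ... | inj₂ v<w = v<w
  ... | inj₁ w<v = ⊥-elim (u≢w (trans (lower-end-is-parent uv u<v)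
                                       (sym (lower-end-is-parent (Edge-sym vw) w<v))))

  ascending : ∀ {u v rest} → Chain Edge (u ∷ v ∷ rest) → NonBacktracking (u ∷ v ∷ rest) →
              depth u < depth v → Ascending (u ∷ v ∷ rest)
  ascending {rest = []}    _                       _          u<v = u<v ∷ [-]
  ascending {rest = _ ∷ _} (cons uv chain@(cons vw _)) (u≢w , nb) u<v =
    u<v ∷ ascending chain nb (ascent-continues uv vw u≢w u<v)

  descending-or-ends-ascending : ∀ {u v rest} → Chain Edge (u ∷ v ∷ rest) →
    NonBacktracking (u ∷ v ∷ rest) → Descending (u ∷ v ∷ rest) ⊎ EndsAscending (u ∷ v ∷ rest)
  descending-or-ends-ascending {rest = []} (cons uv _) _ with edge-direction uv
  ... | inj₁ v<u = inj₁ (v<u ∷ [-])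
  ... | inj₂ u<v = inj₂ u<v
  descending-or-ends-ascending {rest = _ ∷ _} (cons uv chain@(cons vw _)) (u≢w , nb)
    with descending-or-ends-ascending chain nb
  ... | inj₂ ends-ascending = inj₂ ends-ascending
  ... | inj₁ descending with edge-direction uv
  ...   | inj₁ v<u = inj₁ (v<u ∷ descending)
  ...   | inj₂ u<v = ⊥-elim (ℕ.<-asym (Linked.head descending) (ascent-continues uv vw u≢w u<v))

  ends-ascending-++ : ∀ p {u v} → EndsAscending (p ++ u ∷ v ∷ []) → depth u < depth v
  ends-ascending-++ []              u<v  = u<v
  ends-ascending-++ (_ ∷ [])        u<v  = u<v
  ends-ascending-++ (_ ∷ _ ∷ [])    u<v  = u<v
  ends-ascending-++ (_ ∷ b ∷ c ∷ p) ends = ends-ascending-++ (b ∷ c ∷ p) ends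

  -- A non-backtracking walk climbs throughout if it starts upwards; otherwise its last step,
  -- a repetition of the downward first step, forces it to descend throughout.
  -- Either way its starting vertex cannot recur.
  no-walk-repeats-first-step : ∀ {x v} p → Chain Edge (x ∷ v ∷ p ++ x ∷ v ∷ []) →
                               NonBacktracking (x ∷ v ∷ p ++ x ∷ v ∷ []) → ⊥
  no-walk-repeats-first-step {x} {v} p walk@(cons xv _) nb = by-first-step (edge-direction xv)
    where
    x∈tail : x ∈ (v ∷ p ++ x ∷ v ∷ [])
    x∈tail = ∈-++⁺ʳ (v ∷ p) (here refl)
    by-first-step : depth v < depth x ⊎ depth x < depth v → ⊥
    by-first-step (inj₂ x<v) =
      head∉tail {R = _<_ on depth} ℕ.<-trans (ℕ.<-irrefl refl) (ascending walk nb x<v) x∈tail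
    by-first-step (inj₁ v<x) with descending-or-ends-ascending walk nb
    ... | inj₁ descending =
      head∉tail {R = _>_ on depth} (λ b<a c<b → ℕ.<-trans c<b b<a) (ℕ.<-irrefl refl) descending x∈tail
    ... | inj₂ ends-ascending = ℕ.<-asym v<x (ends-ascending-++ (x ∷ v ∷ p) ends-ascending)

  acyclic : ¬ HasCycle Edge
  acyclic (_ , _ ∷ [] , _ , s≤s () , _)
  acyclic (x , v₁ ∷ v₂ ∷ vs , unique@(x∉ ∷ v₁∉ ∷ _) , _ , cycle@(cons xv₁ _)) =
    no-walk-repeats-first-step (v₂ ∷ vs) (chain-snoc (x ∷ v₁ ∷ v₂ ∷ vs) cycle xv₁)
      (cycle-nonBacktracking vs unique (All.map ≢-sym x∉) (All.map ≢-sym v₁∉))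

  edge-parity : ∀ {u v} → Edge u v → parity (depth u) ≡ parity (depth v) ⁻¹
  edge-parity {u} {v} e with edge-depth e
  ... | inj₁ v↑u = trans (cong parity (sym v↑u)) (parity-suc (depth v))
  ... | inj₂ u↑v = sym (⁻¹-selfInverse (trans (sym (parity-suc (depth u))) (cong parity u↑v)))

  pathLength-parity : ∀ {x y p} → Chain Edge p → Ends x y p →
                      parity (pathLength p) ≡ parity (depth x) ℙ.+ parity (depth y)
  pathLength-parity _ (single x) = sym (ℙ.p+p≡0ℙ (parity (depth x)))
  pathLength-parity {x} {z} (cons xy chain) (extend {y = y} {vs = vs} ends) = begin
    parity (suc (length vs))                     ≡⟨ parity-suc (length vs) ⟩
    parity (length vs) ⁻¹                        ≡⟨ cong _⁻¹ (pathLength-parity chain ends) ⟩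
    (parity (depth y) ℙ.+ parity (depth z)) ⁻¹   ≡⟨ ⁻¹-distribˡ-+ (parity (depth y)) _ ⟩
    parity (depth y) ⁻¹ ℙ.+ parity (depth z)     ≡⟨ cong (ℙ._+ parity (depth z)) (sym (edge-parity xy)) ⟩
    parity (depth x) ℙ.+ parity (depth z)        ∎
    where open ≡-Reasoning

  even-if-leaves-at-even-depth : (∀ x → IsLeaf Edge x → parity (depth x) ≡ 0ℙ) → IsEvenTree Edge
  even-if-leaves-at-even-depth leaf-even x y x-leaf y-leaf _ p (chain , _ , ends) =
    parity≡0ℙ⇒even (pathLength p) (begin
      parity (pathLength p)                   ≡⟨ pathLength-parity chain ends ⟩
      parity (depth x) ℙ.+ parity (depth y)   ≡⟨ cong₂ ℙ._+_ (leaf-even x x-leaf) (leaf-even y y-leaf) ⟩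
      0ℙ                                      ∎)
    where open ≡-Reasoning

  has-child⇒¬leaf : ∀ {v c} → v ≢ root → c ≢ root → parent c ≡ v → ¬ IsLeaf Edge v
  has-child⇒¬leaf {v} {c} v≢root c≢root parent≡v (_ , _ , unique-neighbour) =
    ℕ.<-irrefl (cong depth parent≡child) (begin-strict
      depth (parent v)  <⟨ ℕ.≤-reflexive (depth-parent v≢root) ⟩
      depth v           ≡⟨ cong depth parent≡v ⟨
      depth (parent c)  <⟨ ℕ.≤-reflexive (depth-parent c≢root) ⟩
      depth c           ∎)
    where
    open ℕ.≤-Reasoning
    parent≡child : parent v ≡ c
    parent≡child = trans (unique-neighbour _ (inj₁ (v≢root , refl)))
                         (sym (unique-neighbour c (inj₂ (c≢root , sym parent≡v))))

  spanningTree : (G : Graph n) → (∀ {v} → v ≢ root → Adj G (parent v) v) → IsSpanningTree G Edge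
  spanningTree G parent-adjacent = Edge⊆Adj , Edge-sym , connected , acyclic
    where
    Edge⊆Adj : ∀ {u v} → Edge u v → Adj G u v
    Edge⊆Adj (inj₁ (u≢root , refl)) = Adj-sym G (parent-adjacent u≢root)
    Edge⊆Adj (inj₂ (v≢root , refl)) = parent-adjacent v≢root

-- Hamiltonian paths

opposite-gap : ∀ {M} d {i j : Fin (suc M)} → d + toℕ i ≡ toℕ j → d + toℕ (opposite j) ≡ toℕ (opposite i)
opposite-gap {M} d {i} {j} gap = begin
  d + toℕ (opposite j)                ≡⟨ cong (d +_) (Fin.opposite-prop j) ⟩
  d + (M ∸ toℕ j)                     ≡⟨ ℕ.m+n∸m≡n (toℕ i) _ ⟨
  toℕ i + (d + (M ∸ toℕ j)) ∸ toℕ i   ≡⟨ cong (_∸ toℕ i) i+d+rest≡M ⟩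
  M ∸ toℕ i                           ≡⟨ Fin.opposite-prop i ⟨
  toℕ (opposite i)                    ∎
  where
  open ≡-Reasoning
  i+d+rest≡M : toℕ i + (d + (M ∸ toℕ j)) ≡ M
  i+d+rest≡M = begin
    toℕ i + (d + (M ∸ toℕ j))   ≡⟨ ℕ.+-assoc (toℕ i) d _ ⟨
    toℕ i + d + (M ∸ toℕ j)     ≡⟨ cong (_+ (M ∸ toℕ j)) (trans (ℕ.+-comm (toℕ i) d) gap) ⟩
    toℕ j + (M ∸ toℕ j)         ≡⟨ ℕ.m+[n∸m]≡n (ℕ.≤-pred (Fin.toℕ<n j)) ⟩
    M                           ∎

record HamiltonianPath {M : ℕ} (G : Graph (suc M)) : Set where
  field
    order : Permutation′ (suc M)
    consecutive-adjacent : ∀ {i j} → 1 + toℕ i ≡ toℕ j → Adj G (order ⟨$⟩ʳ i) (order ⟨$⟩ʳ j)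

  vertexAt : Fin (suc M) → Fin (suc M)
  vertexAt i = order ⟨$⟩ʳ i

  position : Fin (suc M) → Fin (suc M)
  position v = order ⟨$⟩ˡ v

reverse : ∀ {M} {G : Graph (suc M)} → HamiltonianPath G → HamiltonianPath G
reverse {G = G} H = record
  { order                = Perm.reverse ∘ₚ order
  ; consecutive-adjacent = λ i+1≡j → Adj-sym G (consecutive-adjacent (opposite-gap 1 i+1≡j))
  }
  where open HamiltonianPath H

-- The Hamiltonian path with the edge between positions s+1 and s+2 replaced by the chord from
-- s to s+2, rooted at position 0: the vertex at s+1 becomes a pendant of s, and every position
-- beyond s+1 has depth one less than its index. For s = M this is the path itself.
module SkipTree {M : ℕ} {G : Graph (suc M)} (H : HamiltonianPath G) (s : Fin (suc M))
  (chord : ∀ {t} → 2 + toℕ s ≡ toℕ t → Adj G (HamiltonianPath.vertexAt H s) (HamiltonianPath.vertexAt H t))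
  where
  open HamiltonianPath H

  positionDepth : ℕ → ℕ
  positionDepth k with k ≤? suc (toℕ s)
  ... | yes _ = k
  ... | no _  = pred k

  positionDepth-≤ : ∀ {k} → k ≤ suc (toℕ s) → positionDepth k ≡ k
  positionDepth-≤ {k} k≤ with k ≤? suc (toℕ s)
  ... | yes _ = refl
  ... | no k≰ = ⊥-elim (k≰ k≤)

  positionDepth-> : ∀ {k} → suc (toℕ s) < k → suc (positionDepth k) ≡ k
  positionDepth-> {suc k} s+1<k with suc k ≤? suc (toℕ s)
  ... | yes k≤ = ⊥-elim (ℕ.<-irrefl refl (ℕ.<-≤-trans s+1<k k≤))
  ... | no _   = refl

  positionDepth-suc : ∀ {k} → k ≢ suc (toℕ s) → positionDepth (suc k) ≡ suc (positionDepth k)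
  positionDepth-suc {k} k≢ with ℕ.<-cmp k (suc (toℕ s))
  ... | tri< k<s+1 _ _ = trans (positionDepth-≤ k<s+1) (cong suc (sym (positionDepth-≤ (ℕ.<⇒≤ k<s+1))))
  ... | tri≈ _ k≡s+1 _ = ⊥-elim (k≢ k≡s+1)
  ... | tri> _ _ s+1<k = trans (ℕ.suc-injective (positionDepth-> (ℕ.m<n⇒m<1+n s+1<k)))
                               (sym (positionDepth-> s+1<k))

  parentPosition : Fin (suc M) → Fin (suc M)
  parentPosition zero = zero
  parentPosition (suc k) with toℕ k ℕ.≟ suc (toℕ s)
  ... | yes _ = s
  ... | no _  = inject₁ k

  parentPosition-depth : ∀ k → k ≢ zero →
                         suc (positionDepth (toℕ (parentPosition k))) ≡ positionDepth (toℕ k)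
  parentPosition-depth zero    k≢0 = ⊥-elim (k≢0 refl)
  parentPosition-depth (suc k) _ with toℕ k ℕ.≟ suc (toℕ s)
  ... | yes k≡s+1 = begin
    suc (positionDepth (toℕ s))        ≡⟨ cong suc (positionDepth-≤ (ℕ.n≤1+n _)) ⟩
    suc (toℕ s)                        ≡⟨ ℕ.suc-injective (positionDepth-> ℕ.≤-refl) ⟨
    positionDepth (suc (suc (toℕ s)))  ≡⟨ cong (positionDepth ∘ suc) k≡s+1 ⟨
    positionDepth (suc (toℕ k))        ∎
    where open ≡-Reasoning
  ... | no k≢s+1 = trans (cong (suc ∘ positionDepth) (Fin.toℕ-inject₁ k)) (sym (positionDepth-suc k≢s+1))

  parentPosition-adjacent : ∀ k → k ≢ zero → Adj G (vertexAt (parentPosition k)) (vertexAt k)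
  parentPosition-adjacent zero    k≢0 = ⊥-elim (k≢0 refl)
  parentPosition-adjacent (suc k) _ with toℕ k ℕ.≟ suc (toℕ s)
  ... | yes k≡s+1 = chord (cong suc (sym k≡s+1))
  ... | no _      = consecutive-adjacent (cong suc (Fin.toℕ-inject₁ k))

  parentPosition-next : ∀ {k l} → 1 + toℕ k ≡ toℕ l → toℕ k ≢ suc (toℕ s) → parentPosition l ≡ k
  parentPosition-next {k} {suc l} k+1≡l+1 k≢s+1 with toℕ l ℕ.≟ suc (toℕ s)
  ... | yes l≡s+1 = ⊥-elim (k≢s+1 (trans (ℕ.suc-injective k+1≡l+1) l≡s+1))
  ... | no _      = Fin.toℕ-injective (trans (Fin.toℕ-inject₁ l) (sym (ℕ.suc-injective k+1≡l+1)))

  root : Fin (suc M)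
  root = vertexAt zero

  parent : Fin (suc M) → Fin (suc M)
  parent v = vertexAt (parentPosition (position v))

  depth : Fin (suc M) → ℕ
  depth v = positionDepth (toℕ (position v))

  position≢zero : ∀ {v} → v ≢ root → position v ≢ zero
  position≢zero v≢root p≡0 = v≢root (trans (sym (inverseʳ order)) (cong vertexAt p≡0))

  depth-parent : ∀ {v} → v ≢ root → suc (depth (parent v)) ≡ depth v
  depth-parent {v} v≢root =
    trans (cong (suc ∘ positionDepth ∘ toℕ) (inverseˡ order))
          (parentPosition-depth (position v) (position≢zero v≢root))

  open RootedTree root parent depth depth-parent

  leaf-position : ∀ {v} → IsLeaf Edge v →
                  toℕ (position v) ≡ 0 ⊎ toℕ (position v) ≡ suc (toℕ s) ⊎ toℕ (position v) ≡ M
  leaf-position {v} leaf with toℕ (position v) ℕ.≟ 0 | toℕ (position v) ℕ.≟ suc (toℕ s)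
                            | toℕ (position v) ℕ.≟ M
  ... | yes p≡0 | _ | _ = inj₁ p≡0
  ... | no _ | yes p≡s+1 | _ = inj₂ (inj₁ p≡s+1)
  ... | no _ | no _ | yes p≡M = inj₂ (inj₂ p≡M)
  ... | no p≢0 | no p≢s+1 | no p≢M = ⊥-elim (has-child⇒¬leaf v≢root child≢root parent-child leaf)
    where
    p<M : toℕ (position v) < M
    p<M = ℕ.≤∧≢⇒< (ℕ.≤-pred (Fin.toℕ<n (position v))) p≢M
    next : Fin (suc M)
    next = fromℕ< (s≤s p<M)
    child : Fin (suc M)
    child = vertexAt next
    v≢root : v ≢ root
    v≢root v≡root = p≢0 (cong toℕ (trans (cong position v≡root) (inverseˡ order)))
    child≢root : child ≢ root
    child≢root child≡root with trans (sym (inverseˡ order)) (trans (cong position child≡root) (inverseˡ order))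
    ... | next≡0 = ℕ.1+n≢0 (trans (sym (Fin.toℕ-fromℕ< (s≤s p<M))) (cong toℕ next≡0))
    parent-child : parent child ≡ v
    parent-child = begin
      vertexAt (parentPosition (position (vertexAt next)))  ≡⟨ cong (vertexAt ∘ parentPosition) (inverseˡ order) ⟩
      vertexAt (parentPosition next)                        ≡⟨ cong vertexAt (parentPosition-next (sym (Fin.toℕ-fromℕ< (s≤s p<M))) p≢s+1) ⟩
      vertexAt (position v)                                 ≡⟨ inverseʳ order ⟩
      v                                                     ∎
      where open ≡-Reasoning

  spanningEvenTree : (suc (toℕ s) ≤ M → parity (suc (toℕ s)) ≡ 0ℙ) → parity (positionDepth M) ≡ 0ℙ →
                     HasSpanningEvenTree G
  spanningEvenTree skipped-even last-even =
    Edge , spanningTree G parent-adjacent , even-if-leaves-at-even-depth leaf-even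
    where
    parent-adjacent : ∀ {v} → v ≢ root → Adj G (parent v) v
    parent-adjacent v≢root =
      subst (Adj G _) (inverseʳ order) (parentPosition-adjacent _ (position≢zero v≢root))
    leaf-even : ∀ v → IsLeaf Edge v → parity (depth v) ≡ 0ℙ
    leaf-even v leaf with leaf-position leaf
    ... | inj₁ p≡0 = cong (parity ∘ positionDepth) p≡0
    ... | inj₂ (inj₁ p≡s+1) = begin
      parity (positionDepth (toℕ (position v)))  ≡⟨ cong (parity ∘ positionDepth) p≡s+1 ⟩
      parity (positionDepth (suc (toℕ s)))       ≡⟨ cong parity (positionDepth-≤ ℕ.≤-refl) ⟩
      parity (suc (toℕ s))                       ≡⟨ skipped-even (subst (_≤ M) p≡s+1 (ℕ.≤-pred (Fin.toℕ<n (position v)))) ⟩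
      0ℙ                                         ∎
      where open ≡-Reasoning
    ... | inj₂ (inj₂ p≡M) = trans (cong (parity ∘ positionDepth) p≡M) last-even

module _ {M : ℕ} {G : Graph (suc M)} where
  open HamiltonianPath using (vertexAt)

  evenPath⇒spanningEvenTree : HamiltonianPath G → parity M ≡ 0ℙ → HasSpanningEvenTree G
  evenPath⇒spanningEvenTree H M-even = spanningEvenTree no-skipped-vertex last-even
    where
    toℕ-last : toℕ (fromℕ M) ≡ M
    toℕ-last = Fin.toℕ-fromℕ M
    no-chord : ∀ {t} → 2 + toℕ (fromℕ M) ≡ toℕ t → Adj G (vertexAt H (fromℕ M)) (vertexAt H t)
    no-chord {t} gap = ⊥-elim (ℕ.1+n≰n (ℕ.≤-trans (ℕ.n≤1+n _)
      (subst (_≤ M) (trans (sym gap) (cong (2 +_) toℕ-last)) (ℕ.≤-pred (Fin.toℕ<n t)))))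
    open SkipTree H (fromℕ M) no-chord
    no-skipped-vertex : suc (toℕ (fromℕ M)) ≤ M → parity (suc (toℕ (fromℕ M))) ≡ 0ℙ
    no-skipped-vertex M+1≤M = ⊥-elim (ℕ.1+n≰n (subst (λ m → suc m ≤ M) toℕ-last M+1≤M))
    last-even : parity (positionDepth M) ≡ 0ℙ
    last-even = trans (cong parity (positionDepth-≤ (subst (M ≤_) (cong suc (sym toℕ-last)) (ℕ.n≤1+n M)))) M-even

  oddChord⇒spanningEvenTree : (H : HamiltonianPath G) → parity M ≡ 1ℙ → ∀ {i j} → parity (toℕ i) ≡ 1ℙ →
                              2 + toℕ i ≡ toℕ j → Adj G (vertexAt H i) (vertexAt H j) → HasSpanningEvenTree G
  oddChord⇒spanningEvenTree H M-odd {i} {j} i-odd gap adj = spanningEvenTree skipped-even last-even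
    where
    chord : ∀ {t} → 2 + toℕ i ≡ toℕ t → Adj G (vertexAt H i) (vertexAt H t)
    chord gap′ = subst (Adj G _ ∘ vertexAt H) (Fin.toℕ-injective (trans (sym gap) gap′)) adj
    open SkipTree H i chord
    skipped-even : suc (toℕ i) ≤ M → parity (suc (toℕ i)) ≡ 0ℙ
    skipped-even _ = trans (parity-suc (toℕ i)) (cong _⁻¹ i-odd)
    i+1<M : suc (toℕ i) < M
    i+1<M = subst (_≤ M) (sym gap) (ℕ.≤-pred (Fin.toℕ<n j))
    last-even : parity (positionDepth M) ≡ 0ℙ
    last-even = sym (⁻¹-selfInverse (begin
      parity (positionDepth M) ⁻¹        ≡⟨ parity-suc (positionDepth M) ⟨
      parity (suc (positionDepth M))     ≡⟨ cong parity (positionDepth-> i+1<M) ⟩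
      parity M                           ≡⟨ M-odd ⟩
      1ℙ                                 ∎))
      where open ≡-Reasoning

  chord⇒spanningEvenTree : (H : HamiltonianPath G) → parity M ≡ 1ℙ → ∀ {i j} →
                           2 + toℕ i ≡ toℕ j → Adj G (vertexAt H i) (vertexAt H j) → HasSpanningEvenTree G
  chord⇒spanningEvenTree H M-odd {i} {j} gap adj with parity (toℕ i) in i-parity
  ... | 1ℙ = oddChord⇒spanningEvenTree H M-odd i-parity gap adj
  ... | 0ℙ = oddChord⇒spanningEvenTree (reverse H) M-odd j′-odd (opposite-gap 2 gap) reversed-adj
    where
    j′-odd : parity (toℕ (opposite j)) ≡ 1ℙ
    j′-odd = begin
      parity (toℕ (opposite j))           ≡⟨ cong parity (Fin.opposite-prop j) ⟩
      parity (M ∸ toℕ j)                  ≡⟨ ℙ.+-identityʳ _ ⟨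
      parity (M ∸ toℕ j) ℙ.+ 0ℙ           ≡⟨ cong (parity (M ∸ toℕ j) ℙ.+_) (trans (cong parity (sym gap)) i-parity) ⟨
      parity (M ∸ toℕ j) ℙ.+ parity (toℕ j) ≡⟨ parity-∸ (ℕ.≤-pred (Fin.toℕ<n j)) ⟩
      parity M                            ≡⟨ M-odd ⟩
      1ℙ                                  ∎
      where open ≡-Reasoning
    reversed-adj : Adj G (vertexAt H (opposite (opposite j))) (vertexAt H (opposite (opposite i)))
    reversed-adj = subst₂ (λ a b → Adj G (vertexAt H a) (vertexAt H b))
                     (sym (Fin.opposite-involutive j)) (sym (Fin.opposite-involutive i)) (Adj-sym G adj)

-- Sorting

module _ {c ℓ₁ ℓ₂} (O : TotalPreorder c ℓ₁ ℓ₂) where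
  open TotalPreorder O using (Carrier; _≲_; total) renaming (refl to ≲-refl; trans to ≲-trans)

  minimum : ∀ {n} (key : Fin (suc n) → Carrier) → ∃ λ m → ∀ v → key m ≲ key v
  minimum {zero} key = zero , λ { zero → ≲-refl }
  minimum {suc n} key with minimum (key ∘ suc)
  ... | m , m-min with total (key zero) (key (suc m))
  ...   | inj₁ 0≲m = zero  , λ { zero → ≲-refl ; (suc v) → ≲-trans 0≲m (m-min v) }
  ...   | inj₂ m≲0 = suc m , λ { zero → m≲0 ; (suc v) → m-min v }

  Sorted : ∀ {n} → (Fin n → Carrier) → Permutation′ n → Set ℓ₂
  Sorted key π = ∀ {i j} → i Fin.≤ j → key (π ⟨$⟩ʳ i) ≲ key (π ⟨$⟩ʳ j)

  sort : ∀ {n} (key : Fin n → Carrier) → ∃ (Sorted key)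
  sort {zero} key = Perm.id , λ { {()} }
  sort {suc n} key with minimum key
  ... | m , m-min with sort (key ∘ Fin.punchIn m)
  ...   | π , π-sorted = Perm.insert zero m π , sorted
    where
    sorted : Sorted key (Perm.insert zero m π)
    sorted {zero}  {j}     _         = m-min _
    sorted {suc i} {suc j} (s≤s i≤j) =
      subst₂ (λ a b → key a ≲ key b) (sym (Perm.insert-punchIn zero m π i)) (sym (Perm.insert-punchIn zero m π j))
        (π-sorted i≤j)

-- Unit interval graphs

intersect⇒≤+1 : ∀ {a b} → Intersect a b → b ℚ.≤ a ℚ.+ 1ℚ
intersect⇒≤+1 (_ , (_ , x≤a+1) , (b≤x , _)) = ℚ.≤-trans b≤x x≤a+1

≤+1⇒intersect : ∀ {a b} → a ℚ.≤ b → b ℚ.≤ a ℚ.+ 1ℚ → Intersect a b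
≤+1⇒intersect {b = b} a≤b b≤a+1 = b , (a≤b , b≤a+1) , (ℚ.≤-refl , b≤b+1)
  where
  b≤b+1 : b ℚ.≤ b ℚ.+ 1ℚ
  b≤b+1 = subst (ℚ._≤ b ℚ.+ 1ℚ) (ℚ.+-identityʳ b) (ℚ.+-monoʳ-≤ b (ℚ.nonNegative⁻¹ 1ℚ))

module UnitInterval {M : ℕ} (G : Graph (suc M)) (connected : ConnectedGraph G) (left : Fin (suc M) → ℚ)
  (unitIntervals : ∀ u v → u ≢ v → (Adj G u v ⇔ Intersect (left u) (left v))) where

  byLeftEnd : ∃ (Sorted ℚ.≤-totalPreorder left)
  byLeftEnd = sort ℚ.≤-totalPreorder left

  order : Permutation′ (suc M)
  order = proj₁ byLeftEnd

  vertexAt position : Fin (suc M) → Fin (suc M)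
  vertexAt i = order ⟨$⟩ʳ i
  position v = order ⟨$⟩ˡ v

  left-mono : ∀ {u v} → toℕ (position u) ≤ toℕ (position v) → left u ℚ.≤ left v
  left-mono pu≤pv = subst₂ (λ a b → left a ℚ.≤ left b) (inverseʳ order) (inverseʳ order) (proj₂ byLeftEnd pu≤pv)

  leftAt-mono : ∀ {i v} → toℕ i ≤ toℕ (position v) → left (vertexAt i) ℚ.≤ left v
  leftAt-mono {i} i≤pv = left-mono (subst (_≤ _) (cong toℕ (sym (inverseˡ order))) i≤pv)

  adjacent⇒close : ∀ {u v} → Adj G u v → left v ℚ.≤ left u ℚ.+ 1ℚ
  adjacent⇒close {u} {v} adj = intersect⇒≤+1 (Equivalence.to (unitIntervals u v u≢v) adj)
    where
    u≢v : u ≢ v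
    u≢v refl = irrefl G adj

  close⇒adjacent : ∀ {i j} → toℕ i < toℕ j → left (vertexAt j) ℚ.≤ left (vertexAt i) ℚ.+ 1ℚ →
                   Adj G (vertexAt i) (vertexAt j)
  close⇒adjacent {i} {j} i<j close =
    Equivalence.from (unitIntervals _ _ vi≢vj) (≤+1⇒intersect (proj₂ byLeftEnd (ℕ.<⇒≤ i<j)) close)
    where
    vi≢vj : vertexAt i ≢ vertexAt j
    vi≢vj vi≡vj = ℕ.<-irrefl (cong toℕ (trans (sym (inverseˡ order)) (trans (cong position vi≡vj) (inverseˡ order)))) i<j

  consecutive-adjacent : ∀ {i j} → 1 + toℕ i ≡ toℕ j → Adj G (vertexAt i) (vertexAt j)
  consecutive-adjacent {i} {j} i+1≡j with connected (vertexAt i) (vertexAt j)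
  ... | _ , chain , _ , ends
    with crossing-edge (λ v → toℕ (position v) ≤ toℕ i) (λ v → toℕ (position v) ≤? toℕ i) chain ends
           (ℕ.≤-reflexive (cong toℕ (inverseˡ order)))
           (λ pj≤i → ℕ.1+n≰n (subst (_≤ toℕ i) (trans (cong toℕ (inverseˡ order)) (sym i+1≡j)) pj≤i))
  ... | u , v , uv , pu≤i , pv≰i = close⇒adjacent (ℕ.≤-reflexive i+1≡j) (begin
    left (vertexAt j)         ≤⟨ leftAt-mono (subst (_≤ toℕ (position v)) i+1≡j (ℕ.≰⇒> pv≰i)) ⟩
    left v                    ≤⟨ adjacent⇒close uv ⟩
    left u ℚ.+ 1ℚ             ≤⟨ ℚ.+-monoˡ-≤ 1ℚ (left-mono (subst (toℕ (position u) ≤_) (cong toℕ (sym (inverseˡ order))) pu≤i)) ⟩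
    left (vertexAt i) ℚ.+ 1ℚ  ∎)
    where open ℚ.≤-Reasoning

  hamiltonianPath : HamiltonianPath G
  hamiltonianPath = record { order = order ; consecutive-adjacent = consecutive-adjacent }

  Chord : Fin (suc M) → Fin (suc M) → Set
  Chord i j = 2 + toℕ i ≡ toℕ j × left (vertexAt j) ℚ.≤ left (vertexAt i) ℚ.+ 1ℚ

  chord? : Dec (∃₂ Chord)
  chord? = Fin.any? λ i → Fin.any? λ j → (2 + toℕ i ℕ.≟ toℕ j) ×-dec (_ ℚ.≤? _)

  chord⇒adjacent : ∀ {i j} → Chord i j → Adj G (vertexAt i) (vertexAt j)
  chord⇒adjacent {i} (gap , close) = close⇒adjacent (subst (toℕ i <_) gap (ℕ.≤-trans (ℕ.n<1+n (toℕ i)) (ℕ.n≤1+n _))) close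

  long-edge⇒chord : ∀ {u v} → Adj G u v → 2 + toℕ (position u) ≤ toℕ (position v) → ∃₂ Chord
  long-edge⇒chord {u} {v} uv gap≤ = position u , next₂ , sym (Fin.toℕ-fromℕ< bound) , (begin
    left (vertexAt next₂)              ≤⟨ leftAt-mono (subst (_≤ toℕ (position v)) (sym (Fin.toℕ-fromℕ< bound)) gap≤) ⟩
    left v                             ≤⟨ adjacent⇒close uv ⟩
    left u ℚ.+ 1ℚ                      ≡⟨ cong (λ w → left w ℚ.+ 1ℚ) (inverseʳ order) ⟨
    left (vertexAt (position u)) ℚ.+ 1ℚ ∎)
    where
    open ℚ.≤-Reasoning
    bound : 2 + toℕ (position u) < suc M
    bound = ℕ.≤-<-trans gap≤ (Fin.toℕ<n (position v))
    next₂ : Fin (suc M)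
    next₂ = fromℕ< bound

  chordless⇒forward-edge-consecutive : ¬ ∃₂ Chord → ∀ {u v} → Adj G u v →
    toℕ (position u) < toℕ (position v) → 1 + toℕ (position u) ≡ toℕ (position v)
  chordless⇒forward-edge-consecutive chordless uv pu<pv with 1 + toℕ (position _) ℕ.≟ toℕ (position _)
  ... | yes consecutive = consecutive
  ... | no ¬consecutive = ⊥-elim (chordless (long-edge⇒chord uv (ℕ.≤∧≢⇒< pu<pv ¬consecutive)))

  chordless⇒pathIsomorphism : ¬ ∃₂ Chord → ∀ u v → Adj G u v ⇔ PathAdj (position u) (position v)
  chordless⇒pathIsomorphism chordless u v = mk⇔ to from
    where
    to : Adj G u v → PathAdj (position u) (position v)
    to uv with ℕ.<-cmp (toℕ (position u)) (toℕ (position v))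
    ... | tri< pu<pv _ _ = inj₁ (chordless⇒forward-edge-consecutive chordless uv pu<pv)
    ... | tri> _ _ pv<pu = inj₂ (chordless⇒forward-edge-consecutive chordless (Adj-sym G uv) pv<pu)
    ... | tri≈ _ pu≡pv _ = ⊥-elim (irrefl G (subst (Adj G u) (sym u≡v) uv))
      where
      u≡v : u ≡ v
      u≡v = trans (sym (inverseʳ order)) (trans (cong vertexAt (Fin.toℕ-injective pu≡pv)) (inverseʳ order))
    from : PathAdj (position u) (position v) → Adj G u v
    from (inj₁ pu+1≡pv) = subst₂ (Adj G) (inverseʳ order) (inverseʳ order) (consecutive-adjacent pu+1≡pv)
    from (inj₂ pv+1≡pu) = Adj-sym G (subst₂ (Adj G) (inverseʳ order) (inverseʳ order) (consecutive-adjacent pv+1≡pu))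

spanningEvenTree-without-vertices : (G : Graph 0) → HasSpanningEvenTree G
spanningEvenTree-without-vertices G = (λ _ _ → ⊥) , ((λ ()) , (λ ()) , (λ ()) , λ { (() , _) }) , λ ()

theorem7 : ∀ (n : ℕ) (G : Graph n) → ConnectedGraph G → IsUnitInterval G →
    ¬ IsoToOddPath G → HasSpanningEvenTree G
theorem7 zero    G _ _ _ = spanningEvenTree-without-vertices G
theorem7 (suc M) G connected (left , unitIntervals) notOddPath = byParity (parity M) refl
  where
  open UnitInterval G connected left unitIntervals
  byParity : ∀ p → parity M ≡ p → HasSpanningEvenTree G
  byParity 0ℙ M-even = evenPath⇒spanningEvenTree hamiltonianPath M-even
  byParity 1ℙ M-odd with chord?
  ... | yes (_ , _ , chord) =
    chord⇒spanningEvenTree hamiltonianPath M-odd (proj₁ chord) (chord⇒adjacent chord)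
  ... | no chordless = ⊥-elim (notOddPath
    (M , parity≡1ℙ⇒odd M-odd , Perm.flip order , chordless⇒pathIsomorphism chordless))
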